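{- Let $G$ be an elementary abelian $2$-group of order $n=2^r$, and let $h$ be an integer with $n/2-1\le h\le n-2$. Then $C_h(G)=Z_h(G)=h+2$, except when $h=n-4$, in which case $C_h(G)=h+2$ and $Z_h(G)=h$.
   Context: $G$ is written additively. For a subset $A\subseteq G$ and positive integer $h$, the $h$-fold restricted sumset $h\hat{\;}A$ is the set of all elements of $G$ that can be written as a sum of $h$ pairwise distinct elements of $A$. Define $C_h(G)=\max\{|A| : A\subseteq G,\ h\hat{\;}A\neq G\}$ and $Z_h(G)=\max\{|A| : A\subseteq G,\ 0\notin h\hat{\;}A\}$. -}

module Defs where

open import Data.Nat using (ℕ; _≤_)
open import Data.Bool using (Bool; false; _xor_)
open import Data.Vec using (Vec; zipWith; replicate)
open import Data.List using (List; []; _∷_; length; foldr)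
open import Data.List.Relation.Unary.Unique.Propositional using (Unique)
open import Data.List.Relation.Binary.Sublist.Propositional using (_⊆_)
open import Data.Product using (Σ; _×_; ∃)
open import Relation.Binary.PropositionalEquality using (_≡_)
open import Relation.Nullary using (¬_)

G : ℕ → Set
G r = Vec Bool r

_⊕_ : ∀ {r} → G r → G r → G r
_⊕_ = zipWith _xor_

0G : ∀ {r} → G r
0G = replicate _ false

Σ⊕ : ∀ {r} → List (G r) → G r
Σ⊕ = foldr _⊕_ 0G

-- A finite subset of G is a duplicate-free list; its size is its length.
-- x ∈ h^A : x is a sum of h pairwise distinct elements of A,
-- i.e. of a sub-list of A (A duplicate-free) of length h.
_∈RS[_]_ : ∀ {r} → G r → ℕ → List (G r) → Set
x ∈RS[ h ] A = Σ (List _) λ B → (B ⊆ A) × (length B ≡ h) × (Σ⊕ B ≡ x)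

RSNotAll : ∀ {r} → ℕ → List (G r) → Set
RSNotAll {r} h A = ¬ (∀ (x : G r) → x ∈RS[ h ] A)

ZeroNotIn : ∀ {r} → ℕ → List (G r) → Set
ZeroNotIn h A = ¬ (0G ∈RS[ h ] A)

IsMaxSize : (r : ℕ) → (List (G r) → Set) → ℕ → Set
IsMaxSize r P m =
  (Σ (List (G r)) λ A → Unique A × length A ≡ m × P A) ×
  (∀ (A : List (G r)) → Unique A → P A → length A ≤ m)

C[_,_]≡_ : ℕ → ℕ → ℕ → Set
C[ h , r ]≡ m = IsMaxSize r (RSNotAll h) m

Z[_,_]≡_ : ℕ → ℕ → ℕ → Set
Z[ h , r ]≡ m = IsMaxSize r (ZeroNotIn h) m

-- Write n = 2 ^ r. Taking complements inside A, x is a sum of h distinct elements of A iff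
-- Σ A ⊕ x is a sum of |A| - h of them. If |A| ≥ h + 3 and n ≤ 2h + 2, fix all but three of
-- these: the remaining h + 3 elements are more than n/2 + 1, so after fixing one more element
-- the target is a sum of two distinct ones by pigeonhole (A and z ⊕ A cannot be disjoint).
-- Hence h^A = G as soon as |A| ≥ h + 3. Conversely, if |A| = h + 2 then Σ A ∉ h^A, since its
-- complement would be two equal elements; so every (h+2)-set, and every zero-sum (h+2)-set,
-- is extremal. Since the elements of G sum to 0, a zero-sum (n-2)-set would have a zero-sum
-- complement of size 2; this is why h = n - 4 is exceptional. There the same complement
-- argument puts 0 in h^A whenever |A| ∈ {n - 3, n - 2}, and an h-set with nonzero sum is extremal.

module Submission where

open import Defs
open import Data.Nat using (ℕ; zero; suc; _+_; _*_; _^_; _∸_; _⊓_; _≤_; _<_; _≤?_; _<?_; s≤s; z≤n)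
open import Data.Nat.Properties
open import Data.Nat.Tactic.RingSolver using (solve-∀)
open import Data.Bool using (Bool; true; false; not; _xor_; _∧_)
open import Data.Bool.Properties
  using (xor-comm; xor-assoc; xor-identityˡ; xor-same; not-distribˡ-xor; ∧-zeroʳ)
  renaming (_≟_ to _≟B_)
open import Data.Vec using ([]; _∷_)
open import Data.Vec.Properties using (≡-dec; ∷-injectiveʳ)
open import Data.Vec.Relation.Binary.Pointwise.Inductive
  using (Pointwise-≡⇒≡; zipWith-comm; zipWith-assoc; zipWith-identityˡ)
open import Data.List using (List; []; _∷_; _++_; length; map; filter; take)
open import Data.List.Properties using (length-++; length-map; length-take)
open import Data.List.Relation.Unary.Any using (here; there; any?)
open import Data.List.Relation.Unary.All using ([]; _∷_)
open import Data.List.Relation.Unary.AllPairs using ([]; _∷_)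
open import Data.List.Relation.Unary.Unique.Propositional using (Unique)
open import Data.List.Relation.Unary.Unique.Propositional.Properties
  using (++⁺; map⁺; filter⁺; take⁺)
open import Data.List.Membership.Propositional using (_∈_; _∉_; find; lose)
open import Data.List.Membership.Propositional.Properties
  using (∈-map⁺; ∈-map⁻; ∈-++⁺ˡ; ∈-++⁺ʳ; ∈-filter⁺; ∈-filter⁻)
open import Data.List.Membership.Propositional.Properties.WithK using (unique∧set⇒bag)
open import Data.List.Relation.Binary.BagAndSetEquality using (∼bag⇒↭)
open import Data.List.Relation.Binary.Permutation.Propositional
  using (_↭_; refl; prep; swap; trans)
open import Data.List.Relation.Binary.Permutation.Propositional.Properties using (↭-length)
open import Data.List.Relation.Binary.Sublist.Propositional
  using (_⊆_; []; _∷_; _∷ʳ_; ⊆-refl; from∈)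
open import Data.List.Relation.Binary.Sublist.Propositional.Properties using (All-resp-⊆)
open import Data.Product using (Σ; _×_; _,_; proj₂)
open import Data.Sum using (_⊎_; inj₁; inj₂)
open import Data.Empty using (⊥-elim)
open import Function using (_∘_; mk⇔)
open import Relation.Nullary using (¬_; Dec; yes; no; ¬?; contradiction)
open import Relation.Binary.PropositionalEquality as ≡
  using (_≡_; _≢_; refl; sym; cong; cong₂; subst; subst₂; module ≡-Reasoning)

private variable
  r k h : ℕ
  a b w x y z : G r
  A B : List (G r)

⊕-comm : (x y : G r) → x ⊕ y ≡ y ⊕ x
⊕-comm x y = Pointwise-≡⇒≡ (zipWith-comm xor-comm x y)

⊕-assoc : (x y z : G r) → (x ⊕ y) ⊕ z ≡ x ⊕ (y ⊕ z)
⊕-assoc x y z = Pointwise-≡⇒≡ (zipWith-assoc xor-assoc x y z)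

⊕-identityˡ : (x : G r) → 0G ⊕ x ≡ x
⊕-identityˡ x = Pointwise-≡⇒≡ (zipWith-identityˡ xor-identityˡ x)

⊕-identityʳ : (x : G r) → x ⊕ 0G ≡ x
⊕-identityʳ x = ≡.trans (⊕-comm x 0G) (⊕-identityˡ x)

⊕-self : (x : G r) → x ⊕ x ≡ 0G
⊕-self []      = refl
⊕-self (b ∷ x) = cong₂ _∷_ (xor-same b) (⊕-self x)

x⊕[x⊕y]≡y : (x y : G r) → x ⊕ (x ⊕ y) ≡ y
x⊕[x⊕y]≡y x y = begin
  x ⊕ (x ⊕ y)  ≡⟨ sym (⊕-assoc x x y) ⟩
  (x ⊕ x) ⊕ y  ≡⟨ cong (_⊕ y) (⊕-self x) ⟩
  0G ⊕ y       ≡⟨ ⊕-identityˡ y ⟩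
  y            ∎
  where open ≡-Reasoning

x⊕[y⊕z]≡y⊕[x⊕z] : (x y z : G r) → x ⊕ (y ⊕ z) ≡ y ⊕ (x ⊕ z)
x⊕[y⊕z]≡y⊕[x⊕z] x y z = begin
  x ⊕ (y ⊕ z)  ≡⟨ sym (⊕-assoc x y z) ⟩
  (x ⊕ y) ⊕ z  ≡⟨ cong (_⊕ z) (⊕-comm x y) ⟩
  (y ⊕ x) ⊕ z  ≡⟨ ⊕-assoc y x z ⟩
  y ⊕ (x ⊕ z)  ∎
  where open ≡-Reasoning

⊕-cancelˡ : (x : G r) → x ⊕ y ≡ x ⊕ z → y ≡ z
⊕-cancelˡ {y = y} {z = z} x e = begin
  y            ≡⟨ sym (x⊕[x⊕y]≡y x y) ⟩
  x ⊕ (x ⊕ y)  ≡⟨ cong (x ⊕_) e ⟩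
  x ⊕ (x ⊕ z)  ≡⟨ x⊕[x⊕y]≡y x z ⟩
  z            ∎
  where open ≡-Reasoning

x⊕y≡0⇒x≡y : x ⊕ y ≡ 0G → x ≡ y
x⊕y≡0⇒x≡y {x = x} {y = y} e = ⊕-cancelˡ y (≡.trans (⊕-comm y x) (≡.trans e (sym (⊕-self y))))

_≟G_ : (x y : G r) → Dec (x ≡ y)
_≟G_ = ≡-dec _≟B_

_∈G?_ : (x : G r) (A : List (G r)) → Dec (x ∈ A)
x ∈G? A = any? (x ≟G_) A

_∉G?_ : (x : G r) (A : List (G r)) → Dec (x ∉ A)
x ∉G? A = ¬? (x ∈G? A)

-- Sums of lists and restricted sums

Σ⊕-++ : (A B : List (G r)) → Σ⊕ (A ++ B) ≡ Σ⊕ A ⊕ Σ⊕ B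
Σ⊕-++ []      B = sym (⊕-identityˡ (Σ⊕ B))
Σ⊕-++ (a ∷ A) B = ≡.trans (cong (a ⊕_) (Σ⊕-++ A B)) (sym (⊕-assoc a (Σ⊕ A) (Σ⊕ B)))

Σ⊕-↭ : A ↭ B → Σ⊕ A ≡ Σ⊕ B
Σ⊕-↭ refl                 = refl
Σ⊕-↭ (prep a p)           = cong (a ⊕_) (Σ⊕-↭ p)
Σ⊕-↭ (swap {ys = B} a b p) =
  ≡.trans (cong (a ⊕_) (cong (b ⊕_) (Σ⊕-↭ p))) (x⊕[y⊕z]≡y⊕[x⊕z] a b (Σ⊕ B))
Σ⊕-↭ (trans p q)          = ≡.trans (Σ⊕-↭ p) (Σ⊕-↭ q)

⊆-complement : B ⊆ A →
  Σ (List (G r)) λ C → C ⊆ A × length A ≡ length B + length C × Σ⊕ A ≡ Σ⊕ B ⊕ Σ⊕ C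
⊆-complement [] = [] , [] , refl , sym (⊕-identityˡ 0G)
⊆-complement {B = B} (a ∷ʳ B⊆A) with ⊆-complement B⊆A
... | C , C⊆A , len , sum =
  a ∷ C , refl ∷ C⊆A , ≡.trans (cong suc len) (sym (+-suc (length B) (length C))) ,
  ≡.trans (cong (a ⊕_) sum) (x⊕[y⊕z]≡y⊕[x⊕z] a (Σ⊕ B) (Σ⊕ C))
⊆-complement {B = a ∷ B} (refl ∷ B⊆A) with ⊆-complement B⊆A
... | C , C⊆A , len , sum =
  C , a ∷ʳ C⊆A , cong suc len , ≡.trans (cong (a ⊕_) sum) (sym (⊕-assoc a (Σ⊕ B) _))

Unique-resp-⊇ : B ⊆ A → Unique A → Unique B
Unique-resp-⊇ []           []          = []
Unique-resp-⊇ (_ ∷ʳ B⊆A)   (_ ∷ A!)    = Unique-resp-⊇ B⊆A A!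
Unique-resp-⊇ (refl ∷ B⊆A) (a∉A ∷ A!)  = All-resp-⊆ B⊆A a∉A ∷ Unique-resp-⊇ B⊆A A!

FullSumset : ℕ → List (G r) → Set
FullSumset h A = ∀ x → x ∈RS[ h ] A

∈RS-here : w ∈RS[ k ] A → (a ⊕ w) ∈RS[ suc k ] (a ∷ A)
∈RS-here (B , B⊆A , refl , refl) = _ ∷ B , refl ∷ B⊆A , refl , refl

∈RS-here′ : (a ⊕ w) ∈RS[ k ] A → w ∈RS[ suc k ] (a ∷ A)
∈RS-here′ {a = a} {w = w} p = subst (_∈RS[ _ ] _) (x⊕[x⊕y]≡y a w) (∈RS-here p)

∈RS-there : w ∈RS[ k ] A → w ∈RS[ k ] (a ∷ A)
∈RS-there (B , B⊆A , len , sum) = B , _ ∷ʳ B⊆A , len , sum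

∈RS-swap : w ∈RS[ k ] (a ∷ b ∷ A) → w ∈RS[ k ] (b ∷ a ∷ A)
∈RS-swap (B , _ ∷ʳ (_ ∷ʳ B⊆A) , len , sum)      = B , _ ∷ʳ (_ ∷ʳ B⊆A) , len , sum
∈RS-swap (B , _ ∷ʳ (refl ∷ B⊆A) , len , sum)    = B , refl ∷ (_ ∷ʳ B⊆A) , len , sum
∈RS-swap (B , refl ∷ (_ ∷ʳ B⊆A) , len , sum)    = B , _ ∷ʳ (refl ∷ B⊆A) , len , sum
∈RS-swap (a ∷ b ∷ B , refl ∷ (refl ∷ B⊆A) , len , sum) =
  b ∷ a ∷ B , refl ∷ (refl ∷ B⊆A) , len , ≡.trans (x⊕[y⊕z]≡y⊕[x⊕z] b a (Σ⊕ B)) sum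

∈RS-one : x ∈ A → x ∈RS[ 1 ] A
∈RS-one {x = x} x∈A = x ∷ [] , from∈ x∈A , refl , ⊕-identityʳ x

∈RS-two : x ∈ A → y ∈ A → x ≢ y → (x ⊕ y) ∈RS[ 2 ] A
∈RS-two (here refl)  (here refl)  x≢y = contradiction refl x≢y
∈RS-two (here refl)  (there y∈A)  _   = ∈RS-here (∈RS-one y∈A)
∈RS-two {x = x} {y = y} (there x∈A) (here refl) _ =
  subst (_∈RS[ 2 ] _) (⊕-comm y x) (∈RS-here (∈RS-one x∈A))
∈RS-two (there x∈A)  (there y∈A)  x≢y = ∈RS-there (∈RS-two x∈A y∈A x≢y)

∈RS[0]⇒≡0G : x ∈RS[ 0 ] A → x ≡ 0G
∈RS[0]⇒≡0G ([] , _ , _ , sum) = sym sum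

∈RS-complement : x ∈RS[ k ] A → length A ≡ h + k → (Σ⊕ A ⊕ x) ∈RS[ h ] A
∈RS-complement {A = A} {h = h} (B , B⊆A , refl , refl) lenA with ⊆-complement B⊆A
... | C , C⊆A , lenA′ , sumA = C , C⊆A , lenC , sym sumC
  where
  lenC : length C ≡ h
  lenC = +-cancelˡ-≡ (length B) _ _
    (≡.trans (sym lenA′) (≡.trans lenA (+-comm h (length B))))
  sumC : Σ⊕ A ⊕ Σ⊕ B ≡ Σ⊕ C
  sumC = begin
    Σ⊕ A ⊕ Σ⊕ B            ≡⟨ ⊕-comm (Σ⊕ A) (Σ⊕ B) ⟩
    Σ⊕ B ⊕ Σ⊕ A            ≡⟨ cong (Σ⊕ B ⊕_) sumA ⟩
    Σ⊕ B ⊕ (Σ⊕ B ⊕ Σ⊕ C)  ≡⟨ x⊕[x⊕y]≡y (Σ⊕ B) (Σ⊕ C) ⟩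
    Σ⊕ C                   ∎
    where open ≡-Reasoning

FullSumset-complement : FullSumset k A → length A ≡ h + k → FullSumset h A
FullSumset-complement {A = A} full lenA x =
  subst (_∈RS[ _ ] A) (x⊕[x⊕y]≡y (Σ⊕ A) x) (∈RS-complement (full (Σ⊕ A ⊕ x)) lenA)

∈RS-full⇒≡Σ⊕ : length A ≡ h → x ∈RS[ h ] A → x ≡ Σ⊕ A
∈RS-full⇒≡Σ⊕ lenA p = sym (x⊕y≡0⇒x≡y (∈RS[0]⇒≡0G (∈RS-complement p lenA)))

0∉RS[2] : Unique A → ¬ (0G ∈RS[ 2 ] A)
0∉RS[2] A! (c ∷ d ∷ [] , B⊆A , refl , sum) with Unique-resp-⊇ B⊆A A!
... | (c≢d ∷ []) ∷ _ = c≢d (x⊕y≡0⇒x≡y (≡.trans (cong (c ⊕_) (sym (⊕-identityʳ d))) sum))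

Σ⊕∉RS : Unique A → length A ≡ h + 2 → ¬ (Σ⊕ A ∈RS[ h ] A)
Σ⊕∉RS {A = A} {h = h} A! lenA p =
  0∉RS[2] A! (subst (_∈RS[ 2 ] A) (⊕-self (Σ⊕ A))
    (∈RS-complement p (≡.trans lenA (+-comm h 2))))

-- Enumerating G and complements in G

allG : (r : ℕ) → List (G r)
allG zero    = [] ∷ []
allG (suc r) = map (false ∷_) (allG r) ++ map (true ∷_) (allG r)

allG-length : ∀ r → length (allG r) ≡ 2 ^ r
allG-length zero    = refl
allG-length (suc r) = begin
  length (map (false ∷_) (allG r) ++ map (true ∷_) (allG r))
    ≡⟨ length-++ (map (false ∷_) (allG r)) ⟩
  length (map (false ∷_) (allG r)) + length (map (true ∷_) (allG r))
    ≡⟨ cong₂ _+_ (length-map _ (allG r)) (length-map _ (allG r)) ⟩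
  length (allG r) + length (allG r)
    ≡⟨ cong₂ _+_ (allG-length r) (≡.trans (allG-length r) (sym (+-identityʳ (2 ^ r)))) ⟩
  2 ^ suc r ∎
  where open ≡-Reasoning

∈-allG : (x : G r) → x ∈ allG r
∈-allG []                = here refl
∈-allG {suc r} (false ∷ x) = ∈-++⁺ˡ (∈-map⁺ (false ∷_) (∈-allG x))
∈-allG {suc r} (true ∷ x)  = ∈-++⁺ʳ (map (false ∷_) (allG r)) (∈-map⁺ (true ∷_) (∈-allG x))

allG-unique : ∀ r → Unique (allG r)
allG-unique zero    = [] ∷ []
allG-unique (suc r) =
  ++⁺ (map⁺ ∷-injectiveʳ (allG-unique r)) (map⁺ ∷-injectiveʳ (allG-unique r)) halves-disjoint
  where
  halves-disjoint : ∀ {v} → ¬ (v ∈ map (false ∷_) (allG r) × v ∈ map (true ∷_) (allG r))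
  halves-disjoint (v∈₀ , v∈₁) with ∈-map⁻ (false ∷_) v∈₀ | ∈-map⁻ (true ∷_) v∈₁
  ... | _ , _ , refl | _ , _ , ()

odd : ℕ → Bool
odd zero    = false
odd (suc n) = not (odd n)

odd-+ : ∀ m n → odd (m + n) ≡ odd m xor odd n
odd-+ zero    n = refl
odd-+ (suc m) n = ≡.trans (cong not (odd-+ m n)) (not-distribˡ-xor (odd m) (odd n))

odd-2^suc : ∀ r → odd (2 ^ suc r) ≡ false
odd-2^suc r = begin
  odd (2 ^ r + (2 ^ r + 0))  ≡⟨ cong (λ m → odd (2 ^ r + m)) (+-identityʳ (2 ^ r)) ⟩
  odd (2 ^ r + 2 ^ r)        ≡⟨ odd-+ (2 ^ r) (2 ^ r) ⟩
  odd (2 ^ r) xor odd (2 ^ r) ≡⟨ xor-same (odd (2 ^ r)) ⟩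
  false                      ∎
  where open ≡-Reasoning

Σ⊕-map-∷ : ∀ b (A : List (G r)) → Σ⊕ (map (b ∷_) A) ≡ (b ∧ odd (length A)) ∷ Σ⊕ A
Σ⊕-map-∷ b []      = cong (_∷ 0G) (sym (∧-zeroʳ b))
Σ⊕-map-∷ b (x ∷ A) = ≡.trans (cong ((b ∷ x) ⊕_) (Σ⊕-map-∷ b A)) (cong (_∷ _) (head-bit b))
  where
  head-bit : ∀ b → b xor (b ∧ odd (length A)) ≡ b ∧ not (odd (length A))
  head-bit false = refl
  head-bit true  = refl

Σ⊕-allG : ∀ s → Σ⊕ (allG (2 + s)) ≡ 0G
Σ⊕-allG s = begin
  Σ⊕ (map (false ∷_) (allG (suc s)) ++ map (true ∷_) (allG (suc s)))
    ≡⟨ Σ⊕-++ (map (false ∷_) (allG (suc s))) _ ⟩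
  Σ⊕ (map (false ∷_) (allG (suc s))) ⊕ Σ⊕ (map (true ∷_) (allG (suc s)))
    ≡⟨ cong₂ _⊕_ (Σ⊕-map-∷ false (allG (suc s))) (Σ⊕-map-∷ true (allG (suc s))) ⟩
  (false ∷ S) ⊕ (odd (length (allG (suc s))) ∷ S)
    ≡⟨ cong₂ _∷_ (≡.trans (cong odd (allG-length (suc s))) (odd-2^suc s)) (⊕-self S) ⟩
  0G ∎
  where
  open ≡-Reasoning
  S : G (suc s)
  S = Σ⊕ (allG (suc s))

∃-subset-of-size : k ≤ 2 ^ r → Σ (List (G r)) λ A → Unique A × length A ≡ k
∃-subset-of-size {k = k} {r = r} k≤2^r =
  take k (allG r) , take⁺ k (allG-unique r) ,
  ≡.trans (length-take k (allG r)) (≡.trans (cong (k ⊓_) (allG-length r)) (m≤n⇒m⊓n≡m k≤2^r))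

_ᶜ : List (G r) → List (G r)
A ᶜ = filter (_∉G? A) (allG _)

∈-ᶜ : x ∉ A → x ∈ A ᶜ
∈-ᶜ {x = x} {A = A} x∉A = ∈-filter⁺ (_∉G? A) (∈-allG x) x∉A

ᶜ-unique : ∀ {r} (A : List (G r)) → Unique (A ᶜ)
ᶜ-unique {r = r} A = filter⁺ (_∉G? A) (allG-unique r)

++-ᶜ-↭ : ∀ {r} {A : List (G r)} → Unique A → A ++ A ᶜ ↭ allG r
++-ᶜ-↭ {r = r} {A = A} A! =
  ∼bag⇒↭ (unique∧set⇒bag A++Aᶜ! (allG-unique r) λ {x} → mk⇔ (λ _ → ∈-allG x) into)
  where
  A++Aᶜ! : Unique (A ++ A ᶜ)
  A++Aᶜ! = ++⁺ A! (ᶜ-unique A) λ (x∈A , x∈Aᶜ) →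
    proj₂ (∈-filter⁻ (_∉G? A) {xs = allG r} x∈Aᶜ) x∈A
  into : ∀ {x} → x ∈ allG r → x ∈ A ++ A ᶜ
  into {x} _ with x ∈G? A
  ... | yes x∈A = ∈-++⁺ˡ x∈A
  ... | no  x∉A = ∈-++⁺ʳ A (∈-ᶜ x∉A)

length-ᶜ : ∀ {r} {A : List (G r)} → Unique A → length A + length (A ᶜ) ≡ 2 ^ r
length-ᶜ {r = r} {A = A} A! =
  ≡.trans (sym (length-++ A)) (≡.trans (↭-length (++-ᶜ-↭ A!)) (allG-length r))

Σ⊕-ᶜ : ∀ {s} {A : List (G (2 + s))} → Unique A → Σ⊕ (A ᶜ) ≡ Σ⊕ A
Σ⊕-ᶜ {s = s} {A = A} A! = sym (x⊕y≡0⇒x≡y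
  (≡.trans (sym (Σ⊕-++ A (A ᶜ))) (≡.trans (Σ⊕-↭ (++-ᶜ-↭ A!)) (Σ⊕-allG s))))

length≤2^ : ∀ {r} {A : List (G r)} → Unique A → length A ≤ 2 ^ r
length≤2^ {A = A} A! = subst (length A ≤_) (length-ᶜ A!) (m≤m+n (length A) (length (A ᶜ)))

-- Large sets have full restricted sumsets

-- Pigeonhole: if A and z ⊕ A were disjoint, G would have more than 2 ^ r elements.
∈RS-pair : ∀ {r z} {A : List (G r)} → Unique A → 2 ^ r < length A + length A → z ≢ 0G →
  z ∈RS[ 2 ] A
∈RS-pair {r} {z} {A} A! big z≢0 with any? (λ a → (z ⊕ a) ∈G? A) A
... | yes p with find p
...   | a , a∈A , za∈A = subst (_∈RS[ 2 ] A) a⊕za≡z (∈RS-two a∈A za∈A a≢za)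
  where
  a⊕za≡z : a ⊕ (z ⊕ a) ≡ z
  a⊕za≡z = ≡.trans (cong (a ⊕_) (⊕-comm z a)) (x⊕[x⊕y]≡y a z)
  a≢za : a ≢ z ⊕ a
  a≢za e = z≢0 (≡.trans (sym a⊕za≡z) (≡.trans (cong (a ⊕_) (sym e)) (⊕-self a)))
∈RS-pair {r} {z} {A} A! big z≢0 | no ¬p =
  contradiction (≡.subst (_≤ 2 ^ r) length-A++zA (length≤2^ A++zA!)) (<⇒≱ big)
  where
  disjoint : ∀ {v} → ¬ (v ∈ A × v ∈ map (z ⊕_) A)
  disjoint {v} (v∈A , v∈zA) with ∈-map⁻ (z ⊕_) v∈zA
  ... | a , a∈A , refl = ¬p (lose v∈A (subst (_∈ A) (sym (x⊕[x⊕y]≡y z a)) a∈A))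
  A++zA! : Unique (A ++ map (z ⊕_) A)
  A++zA! = ++⁺ A! (map⁺ (⊕-cancelˡ z) A!) disjoint
  length-A++zA : length (A ++ map (z ⊕_) A) ≡ length A + length A
  length-A++zA = ≡.trans (length-++ A) (cong (length A +_) (length-map (z ⊕_) A))

-- One of a, b differs from w; its sum with w is a nonzero target for the remaining elements.
FullSumset-three : ∀ {r a b} {A : List (G r)} →
  Unique (a ∷ b ∷ A) → 2 ^ r < suc (length A) + suc (length A) →
  FullSumset 3 (a ∷ b ∷ A)
FullSumset-three {a = a} {b = b} ((a≢b ∷ a∉A) ∷ (b∉A ∷ A!)) big w with a ≟G w
... | no a≢w = ∈RS-here′ (∈RS-pair (b∉A ∷ A!) big (a≢w ∘ x⊕y≡0⇒x≡y))
... | yes refl = ∈RS-swap (∈RS-here′ (∈RS-pair (a∉A ∷ A!) big (a≢b ∘ sym ∘ x⊕y≡0⇒x≡y)))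

FullSumset-∷ : FullSumset k A → FullSumset (suc k) (a ∷ A)
FullSumset-∷ {a = a} full w = ∈RS-here′ (full (a ⊕ w))

FullSumset-of-length : ∀ {r} {A : List (G r)} j → Unique A → length A ≡ j + (3 + h) →
  2 ^ r ≤ 2 * h + 2 →
  FullSumset (j + 3) A
FullSumset-of-length {h = h} {A = a ∷ b ∷ A} zero A! lenA 2^r≤ =
  FullSumset-three A! (subst (λ l → _ < suc l + suc l) (sym (suc-injective (suc-injective lenA)))
    (s≤s (≤-trans 2^r≤ (≤-trans (n≤1+n _) (≤-reflexive (1+[2h+2]≡ h))))))
  where
  1+[2h+2]≡ : ∀ h → suc (2 * h + 2) ≡ suc h + suc (suc h)
  1+[2h+2]≡ = solve-∀
FullSumset-of-length {A = a ∷ A} (suc j) (_ ∷ A!) lenA 2^r≤ =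
  FullSumset-∷ (FullSumset-of-length j A! (suc-injective lenA) 2^r≤)

FullSumset-of-large : ∀ {r} {A : List (G r)} → Unique A → h + 2 < length A → 2 ^ r ≤ 2 * h + 2 →
  FullSumset h A
FullSumset-of-large {h = h} {A = A} A! big 2^r≤ =
  FullSumset-complement (FullSumset-of-length j A! lenA 2^r≤) lenA′
  where
  3+h≤ : 3 + h ≤ length A
  3+h≤ = subst (_≤ length A) (cong suc (+-comm h 2)) big
  j : ℕ
  j = length A ∸ (3 + h)
  lenA : length A ≡ j + (3 + h)
  lenA = sym (m∸n+n≡m 3+h≤)
  lenA′ : length A ≡ h + (j + 3)
  lenA′ = ≡.trans lenA (j+[3+h]≡h+[j+3] j h)
    where
    j+[3+h]≡h+[j+3] : ∀ j h → j + (3 + h) ≡ h + (j + 3)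
    j+[3+h]≡h+[j+3] = solve-∀

length≤h+2 : ∀ {r} {A : List (G r)} → Unique A → 2 ^ r ≤ 2 * h + 2 → ¬ FullSumset h A →
  length A ≤ h + 2
length≤h+2 {h = h} {A = A} A! 2^r≤ ¬full with length A ≤? h + 2
... | yes ≤h+2 = ≤h+2
... | no  ≰h+2 = contradiction (FullSumset-of-large A! (≰⇒> ≰h+2) 2^r≤) ¬full

ZeroSumSet : ∀ r → ℕ → Set
ZeroSumSet r k = Σ (List (G r)) λ L → Unique L × length L ≡ k × Σ⊕ L ≡ 0G

zeroSumSet-of-large : k + 2 < 2 ^ r → 2 ^ r ≤ 2 * k + 2 → ZeroSumSet r k
zeroSumSet-of-large {k = k} {r = r} big 2^r≤ with FullSumset-of-large (allG-unique r) big′ 2^r≤ 0G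
  where
  big′ : k + 2 < length (allG r)
  big′ = subst (k + 2 <_) (sym (allG-length r)) big
... | L , L⊆G , lenL , ΣL≡0 = L , Unique-resp-⊇ L⊆G (allG-unique r) , lenL , ΣL≡0

zeroSumSet-ᶜ : ∀ {s m} → ZeroSumSet (2 + s) k → k + m ≡ 2 ^ (2 + s) → ZeroSumSet (2 + s) m
zeroSumSet-ᶜ {k = k} (L , L! , refl , ΣL≡0) k+m≡2^r =
  L ᶜ , ᶜ-unique L , +-cancelˡ-≡ k _ _ (≡.trans (length-ᶜ L!) (sym k+m≡2^r)) ,
  ≡.trans (Σ⊕-ᶜ L!) ΣL≡0

k<m≤k+2⇒m≡k+1∨m≡k+2 : ∀ {k m} → k < m → m ≤ k + 2 → m ≡ k + 1 ⊎ m ≡ k + 2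
k<m≤k+2⇒m≡k+1∨m≡k+2 {k} {m} k<m m≤k+2 with m ≤? k + 1
... | yes m≤k+1 = inj₁ (≤-antisym m≤k+1 (subst (_≤ m) (+-comm 1 k) k<m))
... | no  m≰k+1 = inj₂ (≤-antisym m≤k+2 (subst (_≤ m) (sym (+-suc k 1)) (≰⇒> m≰k+1)))

-- Sizes up to 2 ^ r - 3 come from the covering lemma for A = G, the sizes 2 ^ r - 1 and 2 ^ r
-- are the complements of {0} and ∅.
zeroSumSet : ∀ s → 2 ^ (2 + s) ≤ 2 * k + 2 → k ≤ 2 ^ (2 + s) → k + 2 ≢ 2 ^ (2 + s) →
  ZeroSumSet (2 + s) k
zeroSumSet {k = k} s 2^r≤ k≤2^r k+2≢2^r with k + 2 <? 2 ^ (2 + s)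
... | yes big = zeroSumSet-of-large big 2^r≤
... | no ¬big with m≤n⇒m<n∨m≡n k≤2^r
...   | inj₂ k≡2^r = zeroSumSet-ᶜ ([] , [] , refl , refl) k≡2^r
...   | inj₁ k<2^r with k<m≤k+2⇒m≡k+1∨m≡k+2 k<2^r (≮⇒≥ ¬big)
...     | inj₁ 2^r≡k+1 = zeroSumSet-ᶜ (0G ∷ [] , [] ∷ [] , refl , ⊕-self 0G)
                           (≡.trans (+-comm 1 k) (sym 2^r≡k+1))
...     | inj₂ 2^r≡k+2 = contradiction (sym 2^r≡k+2) k+2≢2^r

nonzeroSumSet : ZeroSumSet r (suc (suc h)) →
  Σ (List (G r)) λ A → Unique A × length A ≡ suc h × Σ⊕ A ≢ 0G
nonzeroSumSet (a ∷ b ∷ A , (a≢b ∷ a∉A) ∷ (b∉A ∷ A!) , lenL , ΣL≡0) with a ≟G 0G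
... | no a≢0 = b ∷ A , b∉A ∷ A! , suc-injective lenL ,
      λ Σ≡0 → a≢0 (≡.trans (x⊕y≡0⇒x≡y ΣL≡0) Σ≡0)
... | yes refl = 0G ∷ A , a∉A ∷ A! , suc-injective lenL ,
      λ Σ≡0 → a≢b (sym (≡.trans (x⊕y≡0⇒x≡y (≡.trans (sym (⊕-identityˡ _)) ΣL≡0))
                               (≡.trans (sym (⊕-identityˡ _)) Σ≡0)))

-- The exceptional case h + 4 = 2 ^ r

+-length-ᶜ≡4 : ∀ {s} {A : List (G (2 + s))} {m} → Unique A → length A ≡ h + m →
  h + 4 ≡ 2 ^ (2 + s) → m + length (A ᶜ) ≡ 4
+-length-ᶜ≡4 {h = h} {A = A} {m = m} A! lenA h+4≡2^r = +-cancelˡ-≡ h _ _ (begin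
  h + (m + length (A ᶜ))  ≡⟨ sym (+-assoc h m _) ⟩
  h + m + length (A ᶜ)    ≡⟨ cong (_+ length (A ᶜ)) (sym lenA) ⟩
  length A + length (A ᶜ) ≡⟨ length-ᶜ A! ⟩
  _                       ≡⟨ sym h+4≡2^r ⟩
  h + 4                   ∎)
  where open ≡-Reasoning

-- If Σ⊕ A lies outside A it lies in the three-element complement, whose sum it also is.
0∈RS-of-size-h+1 : ∀ {s} {A : List (G (2 + s))} → h + 4 ≡ 2 ^ (2 + s) → Unique A →
  length A ≡ h + 1 → 0G ∈RS[ h ] A
0∈RS-of-size-h+1 {A = A} h+4≡2^r A! lenA with Σ⊕ A ∈G? A
... | yes t∈A = subst (_∈RS[ _ ] A) (⊕-self (Σ⊕ A)) (∈RS-complement (∈RS-one t∈A) lenA)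
... | no  t∉A = ⊥-elim (Σ⊕∉RS (ᶜ-unique A) lenAᶜ
      (subst (_∈RS[ 1 ] (A ᶜ)) (sym (Σ⊕-ᶜ A!)) (∈RS-one (∈-ᶜ t∉A))))
  where
  lenAᶜ : length (A ᶜ) ≡ 1 + 2
  lenAᶜ = suc-injective (+-length-ᶜ≡4 A! lenA h+4≡2^r)

-- A nonzero Σ⊕ A is a sum of two elements of A; a zero one is the sum of the two-element complement.
0∈RS-of-size-h+2 : ∀ {s} {A : List (G (2 + s))} → 1 ≤ h → h + 4 ≡ 2 ^ (2 + s) → Unique A →
  length A ≡ h + 2 → 0G ∈RS[ h ] A
0∈RS-of-size-h+2 {h = h} {A = A} 1≤h h+4≡2^r A! lenA with Σ⊕ A ≟G 0G
... | no t≢0 = subst (_∈RS[ _ ] A) (⊕-self (Σ⊕ A)) (∈RS-complement (∈RS-pair A! big t≢0) lenA)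
  where
  big : _ < length A + length A
  big = subst₂ _≤_ (≡.trans (+-comm (h + 4) 1) (cong suc h+4≡2^r))
          (≡.trans (h+4+h≡[h+2]+[h+2] h) (cong₂ _+_ (sym lenA) (sym lenA)))
          (+-monoʳ-≤ (h + 4) 1≤h)
    where
    h+4+h≡[h+2]+[h+2] : ∀ h → h + 4 + h ≡ h + 2 + (h + 2)
    h+4+h≡[h+2]+[h+2] = solve-∀
... | yes t≡0 = ⊥-elim (0∉RS[2] (ᶜ-unique A)
      (A ᶜ , ⊆-refl , lenAᶜ , ≡.trans (Σ⊕-ᶜ A!) t≡0))
  where
  lenAᶜ : length (A ᶜ) ≡ 2
  lenAᶜ = suc-injective (suc-injective (+-length-ᶜ≡4 A! lenA h+4≡2^r))

length≤h : ∀ {s} {A : List (G (2 + s))} → 1 ≤ h → 2 ^ (2 + s) ≤ 2 * h + 2 →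
  h + 4 ≡ 2 ^ (2 + s) → Unique A → ZeroNotIn h A → length A ≤ h
length≤h {h = h} {A = A} 1≤h 2^r≤ h+4≡2^r A! 0∉ with length A ≤? h
... | yes ≤h = ≤h
... | no  ≰h with k<m≤k+2⇒m≡k+1∨m≡k+2 (≰⇒> ≰h) (length≤h+2 A! 2^r≤ (λ full → 0∉ (full 0G)))
...   | inj₁ lenA = contradiction (0∈RS-of-size-h+1 h+4≡2^r A! lenA) 0∉
...   | inj₂ lenA = contradiction (0∈RS-of-size-h+2 1≤h h+4≡2^r A! lenA) 0∉

RSNotAll-witness : h + 2 ≤ 2 ^ r → Σ (List (G r)) λ A → Unique A × length A ≡ h + 2 × RSNotAll h A
RSNotAll-witness h+2≤2^r with ∃-subset-of-size h+2≤2^r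
... | A , A! , lenA = A , A! , lenA , λ full → Σ⊕∉RS A! lenA (full (Σ⊕ A))

ZeroNotIn-witness : ∀ s → 2 ^ (2 + s) ≤ 2 * h + 2 → h + 2 ≤ 2 ^ (2 + s) → h + 4 ≢ 2 ^ (2 + s) →
  Σ (List (G (2 + s))) λ A → Unique A × length A ≡ h + 2 × ZeroNotIn h A
ZeroNotIn-witness {h = h} s 2^r≤ h+2≤2^r h+4≢2^r with zeroSumSet s 2^r≤′ h+2≤2^r h+2+2≢2^r
  where
  2^r≤′ : 2 ^ (2 + s) ≤ 2 * (h + 2) + 2
  2^r≤′ = ≤-trans 2^r≤ (+-monoˡ-≤ 2 (*-monoʳ-≤ 2 (m≤m+n h 2)))
  h+2+2≢2^r : h + 2 + 2 ≢ 2 ^ (2 + s)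
  h+2+2≢2^r e = h+4≢2^r (≡.trans (sym (+-assoc h 2 2)) e)
... | A , A! , lenA , ΣA≡0 =
  A , A! , lenA , λ 0∈ → Σ⊕∉RS A! lenA (subst (_∈RS[ h ] A) (sym ΣA≡0) 0∈)

ZeroNotIn-witness-exceptional : ∀ s → 1 ≤ h → 2 ^ (2 + s) ≤ 2 * h + 2 → h + 4 ≡ 2 ^ (2 + s) →
  Σ (List (G (2 + s))) λ A → Unique A × length A ≡ h × ZeroNotIn h A
ZeroNotIn-witness-exceptional {h = suc h} s _ 2^r≤ h+4≡2^r
  with nonzeroSumSet (zeroSumSet-of-large big 2^r≤′)
  where
  big : suc (suc h) + 2 < 2 ^ (2 + s)
  big = ≤-reflexive (≡.trans (3+h+3≡1+h+4 h) h+4≡2^r)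
    where
    3+h+3≡1+h+4 : ∀ h → suc (suc (suc h) + 2) ≡ suc h + 4
    3+h+3≡1+h+4 = solve-∀
  2^r≤′ : 2 ^ (2 + s) ≤ 2 * suc (suc h) + 2
  2^r≤′ = ≤-trans 2^r≤ (+-monoˡ-≤ 2 (*-monoʳ-≤ 2 (n≤1+n (suc h))))
... | A , A! , lenA , ΣA≢0 = A , A! , lenA , λ 0∈ → ΣA≢0 (sym (∈RS-full⇒≡Σ⊕ lenA 0∈))

theorem1p3 : (r h : ℕ) → 1 ≤ h → 2 ^ r ≤ 2 * h + 2 → h + 2 ≤ 2 ^ r →
    (C[ h , r ]≡ (h + 2))
    × (h + 4 ≢ 2 ^ r → Z[ h , r ]≡ (h + 2))
    × (h + 4 ≡ 2 ^ r → Z[ h , r ]≡ h)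
theorem1p3 zero h 1≤h _ h+2≤2^r = contradiction (+-cancelʳ-≤ 2 h 0 (≤-trans h+2≤2^r (s≤s z≤n))) (<⇒≱ 1≤h)
theorem1p3 (suc zero) h 1≤h _ h+2≤2^r = contradiction (+-cancelʳ-≤ 2 h 0 h+2≤2^r) (<⇒≱ 1≤h)
theorem1p3 (suc (suc s)) h 1≤h 2^r≤ h+2≤2^r =
  ( RSNotAll-witness h+2≤2^r
  , λ A A! → length≤h+2 A! 2^r≤ ) ,
  ( λ h+4≢2^r → ZeroNotIn-witness s 2^r≤ h+2≤2^r h+4≢2^r
  , λ A A! 0∉ → length≤h+2 A! 2^r≤ (λ full → 0∉ (full 0G)) ) ,
  ( λ h+4≡2^r → ZeroNotIn-witness-exceptional s 1≤h 2^r≤ h+4≡2^r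
  , λ A A! → length≤h 1≤h 2^r≤ h+4≡2^r A! )
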